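{- Let $n>11$ be an integer and write $n=7k+r$ with integers $k\ge 0$ and $0\le r\le 6$. Then \[\gamma^{SID}(C_n(1,3))=\begin{cases}4k & r=0,\\ 4k+1 & r=1,\\ 4k+2 & r=2,\\ 4k+3 & r\in\{3,4\},\\ 4k+4 & r\in\{5,6\}.\end{cases}\]
   Context: All graphs are simple and undirected. For a graph $G=(V,E)$ and $u\in V$, $N[u]=\{u\}\cup\{v: uv\in E\}$. A code is a nonempty $C\subseteq V$, and $I(C;u)=N[u]\cap C$. $C$ is self-identifying if $I(C;u)\setminus I(C;v)\neq\emptyset$ for all distinct $u,v\in V$. $\gamma^{SID}(G)$ is the minimum cardinality of a self-identifying code in a finite graph $G$. The circulant graph $C_n(1,3)$ has vertex set $\mathbb{Z}_n$, and the open neighbourhood of $u$ is $\{u\pm1,u\pm3\}$ modulo $n$. -}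

module Defs where

open import Data.Nat using (ℕ; _+_; _*_; _≤_)
open import Data.Fin using (Fin; toℕ)
open import Data.Fin.Subset using (Subset; _∈_; _∉_; ∣_∣; Nonempty)
open import Data.Product using (Σ; ∃; _×_)
open import Data.Sum using (_⊎_)
open import Relation.Binary.PropositionalEquality using (_≡_)
open import Relation.Nullary using (¬_)

-- v = u + d (mod n), for 0 ≤ toℕ u, toℕ v < n and 0 ≤ d < n.
Step : (n : ℕ) → Fin n → ℕ → Fin n → Set
Step n u d v = (toℕ u + d ≡ toℕ v) ⊎ (toℕ u + d ≡ toℕ v + n)

InClosedNbhd : (n : ℕ) → Fin n → Fin n → Set
InClosedNbhd n u v =
  (u ≡ v) ⊎ Step n u 1 v ⊎ Step n v 1 u ⊎ Step n u 3 v ⊎ Step n v 3 u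

SelfIdentifying : (n : ℕ) → Subset n → Set
SelfIdentifying n C =
  Nonempty C ×
  (∀ (u v : Fin n) → ¬ (u ≡ v) →
     ∃ λ (w : Fin n) → (w ∈ C) × InClosedNbhd n u w × ¬ InClosedNbhd n v w)

γSID≡ : (n : ℕ) → ℕ → Set
γSID≡ n m =
  (Σ (Subset n) λ C → SelfIdentifying n C × ∣ C ∣ ≡ m) ×
  (∀ (C : Subset n) → SelfIdentifying n C → m ≤ ∣ C ∣)

sidValue : ℕ → ℕ → ℕ
sidValue k 0 = 4 * k
sidValue k 1 = 4 * k + 1
sidValue k 2 = 4 * k + 2
sidValue k 3 = 4 * k + 3
sidValue k 4 = 4 * k + 3
sidValue k 5 = 4 * k + 4
sidValue k 6 = 4 * k + 4
sidValue k _ = 0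

-- A code is a 0/1 sequence on ℤ_n, and being self-identifying is a local property: around
-- every vertex u the codewords within distance 3 of u must separate u from each of
-- u − 6, …, u + 6, a condition on the seven bits at u − 3, …, u + 3 (necessary once n > 6,
-- sufficient once n > 12). Along a sequence of valid windows a potential ψ on six
-- consecutive bits, found by computer search, satisfies 7 b = 4 + ψ(after) − ψ(before) + ε
-- with an excess ε ≥ 0, where b is the bit entering the window. Summing once around the
-- cycle gives 7 |C| = 4 n + Σ ε, and an exhaustive search shows that a positive excess
-- makes Σ ε ≥ 3 within twelve windows; hence 7 |C| = 4 n or 7 |C| ≥ 4 n + 3, which is the
-- lower bound. The bound is attained by repeating a block 0001111 (0011110 when r = 4) and
-- appending a tail of length r, verified with the same window criterion; for n = 12 one
-- code of size 8 is checked directly.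

module Submission where

open import Defs
open import Data.Bool using (Bool; true; false; T; not; _∧_; _∨_)
open import Data.Bool.Properties using (T-∧; T-∨; T-≡)
open import Data.Fin as Fin using (Fin; toℕ; combine)
open import Data.Fin.Properties using (toℕ-fromℕ<; toℕ-injective; toℕ<n; all?; any?) renaming (_≟_ to _≟ᶠ_)
open import Data.Fin.Subset using (Subset; _∈_; Nonempty; ∣_∣)
open import Data.Fin.Subset.Properties using (_∈?_; nonempty?)
open import Data.List using (List; []; _∷_; _++_; length; take)
open import Data.List.Properties using (length-++; length-take)
open import Data.Nat
open import Data.Nat.DivMod
  using ( _%_; _mod_; %-distribˡ-+; m%n%n≡m%n; m<n⇒m%n≡m; m≤n⇒[n∸m]%m≡n%m
        ; [m+n]%n≡m%n; [m+kn]%n≡m%n; m*n%n≡0; m%n<n)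
open import Data.Nat.Properties
open import Algebra.Properties.CommutativeSemigroup +-commutativeSemigroup using (interchange; xy∙z≈xz∙y)
open import Data.Nat.Tactic.RingSolver using (solve-∀)
open import Data.Product using (Σ-syntax; ∃-syntax; _×_; _,_; proj₁; proj₂)
open import Data.Sum using (_⊎_; inj₁; inj₂)
open import Data.Vec using (Vec; lookup; toList; fromList; []; _∷_)
open import Data.Vec.Properties using ([]=⇒lookup; lookup⇒[]=; toList∘fromList)
open import Function using (_∘_)
open import Function.Bundles using (Equivalence; _⇔_; mk⇔)
open import Relation.Binary.PropositionalEquality
open import Relation.Nullary using (¬_; contradiction; Dec; ¬?; yes; no)
open import Relation.Nullary.Decidable
  using (True; ⌊_⌋; toWitness; _×-dec_; _⊎-dec_; _→-dec_; from-yes)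

open Equivalence using (to; from)

bit : Bool → ℕ
bit false = 0
bit true  = 1

≤-lit : ∀ {m n} {m≤n : True (m ≤? n)} → m ≤ n
≤-lit {m≤n = m≤n} = toWitness m≤n

_⇒ᵇ_ : Bool → Bool → Bool
a ⇒ᵇ b = not a ∨ b

⇒ᵇ-mp : ∀ a {b} → T (a ⇒ᵇ b) → T a → T b
⇒ᵇ-mp true t _ = t

anyᵇ< : ℕ → (ℕ → Bool) → Bool
anyᵇ< zero    p = false
anyᵇ< (suc n) p = anyᵇ< n p ∨ p n

allᵇ< : ℕ → (ℕ → Bool) → Bool
allᵇ< zero    p = true
allᵇ< (suc n) p = allᵇ< n p ∧ p n

anyᵇ<-sound : ∀ n {p} → T (anyᵇ< n p) → ∃[ k ] k < n × T (p k)
anyᵇ<-sound (suc n) t with to T-∨ t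
... | inj₁ t′ = let k , k<n , pk = anyᵇ<-sound n t′ in k , m<n⇒m<1+n k<n , pk
... | inj₂ pn = n , ≤-refl , pn

anyᵇ<-complete : ∀ {n p k} → k < n → T (p k) → T (anyᵇ< n p)
anyᵇ<-complete {suc n} k<1+n pk with m<1+n⇒m<n∨m≡n k<1+n
... | inj₁ k<n  = from T-∨ (inj₁ (anyᵇ<-complete k<n pk))
... | inj₂ refl = from T-∨ (inj₂ pk)

allᵇ<-sound : ∀ {n p k} → T (allᵇ< n p) → k < n → T (p k)
allᵇ<-sound {suc n} t k<1+n with to T-∧ t | m<1+n⇒m<n∨m≡n k<1+n
... | t′ , _  | inj₁ k<n  = allᵇ<-sound t′ k<n
... | _  , pn | inj₂ refl = pn

allᵇ<-complete : ∀ n {p} → (∀ k → k < n → T (p k)) → T (allᵇ< n p)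
allᵇ<-complete zero    h = _
allᵇ<-complete (suc n) h =
  from T-∧ (allᵇ<-complete n (λ k k<n → h k (m<n⇒m<1+n k<n)) , h n ≤-refl)

∑< : ℕ → (ℕ → ℕ) → ℕ
∑< zero    f = 0
∑< (suc n) f = f 0 + ∑< n (λ i → f (suc i))

∑<-cong : ∀ n {f g} → (∀ i → i < n → f i ≡ g i) → ∑< n f ≡ ∑< n g
∑<-cong zero    e = refl
∑<-cong (suc n) e = cong₂ _+_ (e 0 z<s) (∑<-cong n (λ i i<n → e (suc i) (s<s i<n)))

∑<-+ : ∀ n f g → ∑< n (λ i → f i + g i) ≡ ∑< n f + ∑< n g
∑<-+ zero    f g = refl
∑<-+ (suc n) f g = trans (cong (f 0 + g 0 +_) (∑<-+ n _ _)) (interchange (f 0) (g 0) _ _)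

∑<-*ˡ : ∀ n c f → ∑< n (λ i → c * f i) ≡ c * ∑< n f
∑<-*ˡ zero    c f = sym (*-zeroʳ c)
∑<-*ˡ (suc n) c f = trans (cong (c * f 0 +_) (∑<-*ˡ n c _)) (sym (*-distribˡ-+ c (f 0) _))

∑<-const : ∀ n c → ∑< n (λ _ → c) ≡ c * n
∑<-const zero    c = sym (*-zeroʳ c)
∑<-const (suc n) c = trans (cong (c +_) (∑<-const n c)) (sym (*-suc c n))

∑<-mono : ∀ {m n} f → m ≤ n → ∑< m f ≤ ∑< n f
∑<-mono f z≤n       = z≤n
∑<-mono f (s≤s m≤n) = +-monoʳ-≤ (f 0) (∑<-mono _ m≤n)

∑<-telescope : ∀ n f → ∑< n (λ i → f (suc i)) + f 0 ≡ ∑< n f + f n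
∑<-telescope zero    f = refl
∑<-telescope (suc n) f = begin
  f 1 + ∑< n (λ i → f (2 + i)) + f 0   ≡⟨ +-comm (f 1 + _) (f 0) ⟩
  f 0 + (f 1 + ∑< n (λ i → f (2 + i))) ≡⟨ cong (f 0 +_) (+-comm (f 1) _) ⟩
  f 0 + (∑< n (λ i → f (2 + i)) + f 1) ≡⟨ cong (f 0 +_) (∑<-telescope n (λ i → f (suc i))) ⟩
  f 0 + (∑< n (λ i → f (suc i)) + f (suc n)) ≡⟨ +-assoc (f 0) _ _ ⟨
  f 0 + ∑< n (λ i → f (suc i)) + f (suc n) ∎
  where open ≡-Reasoning

∑<-rotate : ∀ n f → (∀ i → f (i + n) ≡ f i) → ∀ j → ∑< n (λ i → f (j + i)) ≡ ∑< n f
∑<-rotate n f periodic zero    = refl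
∑<-rotate n f periodic (suc j) = begin
  ∑< n (λ i → f (suc j + i))  ≡⟨ ∑<-cong n (λ i _ → cong f (+-suc j i)) ⟨
  ∑< n (λ i → f (j + suc i))  ≡⟨ +-cancelʳ-≡ _ _ _ step ⟩
  ∑< n (λ i → f (j + i))      ≡⟨ ∑<-rotate n f periodic j ⟩
  ∑< n f                      ∎
  where
  open ≡-Reasoning
  step : ∑< n (λ i → f (j + suc i)) + f (j + 0) ≡ ∑< n (λ i → f (j + i)) + f (j + 0)
  step = trans (∑<-telescope n (λ i → f (j + i)))
               (cong (∑< n (λ i → f (j + i)) +_) (trans (periodic j) (cong f (sym (+-identityʳ j)))))

∑<-nonzero : ∀ n f → ∑< n f ≢ 0 → ∃[ i ] i < n × f i ≢ 0
∑<-nonzero zero    f ≢0 = contradiction refl ≢0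
∑<-nonzero (suc n) f ≢0 with f 0 ≟ 0
... | no  f0≢0 = 0 , z<s , f0≢0
... | yes f0≡0 =
  let i , i<n , fi≢0 = ∑<-nonzero n (λ i → f (suc i)) (≢0 ∘ cong₂ _+_ f0≡0) in suc i , s<s i<n , fi≢0

[m+n%d]%d≡[m+n]%d : ∀ m n d .{{_ : NonZero d}} → (m + n % d) % d ≡ (m + n) % d
[m+n%d]%d≡[m+n]%d m n d = begin
  (m + n % d) % d          ≡⟨ %-distribˡ-+ m (n % d) d ⟩
  (m % d + n % d % d) % d  ≡⟨ cong (λ t → (m % d + t) % d) (m%n%n≡m%n n d) ⟩
  (m % d + n % d) % d      ≡⟨ %-distribˡ-+ m n d ⟨
  (m + n) % d              ∎
  where open ≡-Reasoning

m<n+n⇒m≡m%n⊎m≡m%n+n : ∀ {m} n .{{_ : NonZero n}} → m < n + n → m ≡ m % n ⊎ m ≡ m % n + n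
m<n+n⇒m≡m%n⊎m≡m%n+n {m} n m<2n with m <? n
... | yes m<n = inj₁ (sym (m<n⇒m%n≡m m<n))
... | no  m≮n = inj₂ (begin
  m               ≡⟨ m∸n+n≡m n≤m ⟨
  m ∸ n + n       ≡⟨ cong (_+ n) (m<n⇒m%n≡m (m<n+o⇒m∸n<o m n m<2n)) ⟨
  (m ∸ n) % n + n ≡⟨ cong (_+ n) (m≤n⇒[n∸m]%m≡n%m n≤m) ⟩
  m % n + n       ∎)
  where
  open ≡-Reasoning
  n≤m : n ≤ m
  n≤m = ≮⇒≥ m≮n

-- Closed adjacency of offsets from a base vertex, read in the infinite graph on ℕ with
-- edges i ∼ i + 1 and i ∼ i + 3; on the cycle it agrees with InClosedNbhd as long as the
-- offsets are closer than N − 3 (InClosedNbhd⇒Adjacent).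
Adjacent : ℕ → ℕ → Set
Adjacent i j = i ≡ j ⊎ 1 + i ≡ j ⊎ 1 + j ≡ i ⊎ 3 + i ≡ j ⊎ 3 + j ≡ i

adjacent? : ∀ i j → Dec (Adjacent i j)
adjacent? i j = i ≟ j ⊎-dec 1 + i ≟ j ⊎-dec 1 + j ≟ i ⊎-dec 3 + i ≟ j ⊎-dec 3 + j ≟ i

Adjacent⇒≤3+ : ∀ {i j} → Adjacent i j → i ≤ 3 + j
Adjacent⇒≤3+ {i} (inj₁ refl)                      = m≤n+m i 3
Adjacent⇒≤3+ {i} (inj₂ (inj₁ refl))               = m≤n+m i 4
Adjacent⇒≤3+ {j = j} (inj₂ (inj₂ (inj₁ refl)))    = m≤n+m (1 + j) 2
Adjacent⇒≤3+ {i} (inj₂ (inj₂ (inj₂ (inj₁ refl)))) = m≤n+m i 6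
Adjacent⇒≤3+ (inj₂ (inj₂ (inj₂ (inj₂ refl))))     = ≤-refl

Adjacent-6⇒range : ∀ {k} → Adjacent 6 k → 3 ≤ k × k ≤ 9
Adjacent-6⇒range (inj₁ refl)                      = ≤-lit , ≤-lit
Adjacent-6⇒range (inj₂ (inj₁ refl))               = ≤-lit , ≤-lit
Adjacent-6⇒range (inj₂ (inj₂ (inj₁ refl)))        = ≤-lit , ≤-lit
Adjacent-6⇒range (inj₂ (inj₂ (inj₂ (inj₁ refl)))) = ≤-lit , ≤-lit
Adjacent-6⇒range (inj₂ (inj₂ (inj₂ (inj₂ refl)))) = ≤-lit , ≤-lit

module Cycle (N : ℕ) .{{_ : NonZero N}} where

  vertex : ℕ → Fin N
  vertex i = i mod N

  toℕ-vertex : ∀ i → toℕ (vertex i) ≡ i % N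
  toℕ-vertex i = toℕ-fromℕ< (m%n<n i N)

  vertex-≡ : ∀ {i j} → i % N ≡ j % N → vertex i ≡ vertex j
  vertex-≡ {i} {j} e = toℕ-injective (trans (toℕ-vertex i) (trans e (sym (toℕ-vertex j))))

  vertex-toℕ : ∀ x → vertex (toℕ x) ≡ x
  vertex-toℕ x = toℕ-injective (trans (toℕ-vertex (toℕ x)) (m<n⇒m%n≡m (toℕ<n x)))

  vertex-periodic : ∀ i → vertex (i + N) ≡ vertex i
  vertex-periodic i = vertex-≡ ([m+n]%n≡m%n i N)

  vertex-+ : ∀ d i → vertex (d + toℕ (vertex i)) ≡ vertex (d + i)
  vertex-+ d i = vertex-≡ (trans (cong (λ t → (d + t) % N) (toℕ-vertex i)) ([m+n%d]%d≡[m+n]%d d i N))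

  vertex-cancel : ∀ {d i j} → d ≤ N → vertex (d + i) ≡ vertex (d + j) → vertex i ≡ vertex j
  vertex-cancel {d} {i} {j} d≤N e = begin
    vertex i                         ≡⟨ vertex-periodic i ⟨
    vertex (i + N)                   ≡⟨ cong vertex (wrap i) ⟩
    vertex (N ∸ d + (d + i))         ≡⟨ vertex-+ (N ∸ d) (d + i) ⟨
    vertex (N ∸ d + toℕ (vertex (d + i))) ≡⟨ cong (λ x → vertex (N ∸ d + toℕ x)) e ⟩
    vertex (N ∸ d + toℕ (vertex (d + j))) ≡⟨ vertex-+ (N ∸ d) (d + j) ⟩
    vertex (N ∸ d + (d + j))         ≡⟨ cong vertex (wrap j) ⟨
    vertex (j + N)                   ≡⟨ vertex-periodic j ⟩
    vertex j                         ∎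
    where
    open ≡-Reasoning
    wrap : ∀ k → k + N ≡ N ∸ d + (d + k)
    wrap k = begin
      k + N             ≡⟨ +-comm k N ⟩
      N + k             ≡⟨ cong (_+ k) (m∸n+n≡m d≤N) ⟨
      N ∸ d + d + k     ≡⟨ +-assoc (N ∸ d) d k ⟩
      N ∸ d + (d + k)   ∎

  Step⇒vertex : ∀ {i d y} → Step N (vertex i) d y → y ≡ vertex (d + i)
  Step⇒vertex {i} {d} {y} (inj₁ e) = begin
    y                         ≡⟨ vertex-toℕ y ⟨
    vertex (toℕ y)            ≡⟨ cong vertex (trans (sym e) (+-comm _ d)) ⟩
    vertex (d + toℕ (vertex i)) ≡⟨ vertex-+ d i ⟩
    vertex (d + i)            ∎
    where open ≡-Reasoning
  Step⇒vertex {i} {d} {y} (inj₂ e) = begin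
    y                         ≡⟨ vertex-toℕ y ⟨
    vertex (toℕ y)            ≡⟨ vertex-periodic (toℕ y) ⟨
    vertex (toℕ y + N)        ≡⟨ cong vertex (trans (sym e) (+-comm _ d)) ⟩
    vertex (d + toℕ (vertex i)) ≡⟨ vertex-+ d i ⟩
    vertex (d + i)            ∎
    where open ≡-Reasoning

  Step⇒vertex⁻ : ∀ {x d i} → d ≤ N → Step N x d (vertex (d + i)) → x ≡ vertex i
  Step⇒vertex⁻ {x} {d} {i} d≤N s = sym (trans (vertex-cancel d≤N (Step⇒vertex s′)) (vertex-toℕ x))
    where
    s′ : Step N (vertex (toℕ x)) d (vertex (d + i))
    s′ = subst (λ z → Step N z d (vertex (d + i))) (sym (vertex-toℕ x)) s

  toℕ-vertex-+ : ∀ d i → toℕ (vertex (d + i)) ≡ (toℕ (vertex i) + d) % N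
  toℕ-vertex-+ d i = begin
    toℕ (vertex (d + i))                ≡⟨ cong toℕ (vertex-+ d i) ⟨
    toℕ (vertex (d + toℕ (vertex i)))   ≡⟨ toℕ-vertex _ ⟩
    (d + toℕ (vertex i)) % N            ≡⟨ cong (_% N) (+-comm d _) ⟩
    (toℕ (vertex i) + d) % N            ∎
    where open ≡-Reasoning

  vertex-Step : ∀ {d} i → d < N → Step N (vertex i) d (vertex (d + i))
  vertex-Step {d} i d<N with m<n+n⇒m≡m%n⊎m≡m%n+n N (+-mono-< (toℕ<n (vertex i)) d<N)
  ... | inj₁ e = inj₁ (trans e (sym (toℕ-vertex-+ d i)))
  ... | inj₂ e = inj₂ (trans e (cong (_+ N) (sym (toℕ-vertex-+ d i))))

  Step-irrefl : ∀ {x d} → 0 < d → d < N → ¬ Step N x d x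
  Step-irrefl {x} 0<d d<N (inj₁ e) = <-irrefl (sym (+-cancelˡ-≡ (toℕ x) _ _ (trans e (sym (+-identityʳ _))))) 0<d
  Step-irrefl {x} 0<d d<N (inj₂ e) = <-irrefl (+-cancelˡ-≡ (toℕ x) _ _ e) d<N

  vertex-injective-≤ : ∀ {i j} → i ≤ j → j < i + N → vertex i ≡ vertex j → i ≡ j
  vertex-injective-≤ {i} {j} i≤j j<i+N e with j ∸ i in eq
  ... | zero  = ≤-antisym i≤j (m∸n≡0⇒m≤n eq)
  ... | suc d = contradiction (subst (Step N (vertex i) (suc d)) (trans (cong vertex j≡) (sym e)) (vertex-Step i d<N))
                              (Step-irrefl z<s d<N)
    where
    j≡ : suc d + i ≡ j
    j≡ = trans (cong (_+ i) (sym eq)) (m∸n+n≡m i≤j)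
    d<N : suc d < N
    d<N = +-cancelʳ-< i (suc d) N (subst₂ _<_ (sym j≡) (+-comm i N) j<i+N)

  vertex-injective : ∀ {i j} → i < j + N → j < i + N → vertex i ≡ vertex j → i ≡ j
  vertex-injective {i} {j} i<j+N j<i+N e with ≤-total i j
  ... | inj₁ i≤j = vertex-injective-≤ i≤j j<i+N e
  ... | inj₂ j≤i = sym (vertex-injective-≤ j≤i i<j+N (sym e))

  Step-total : ∀ x y → ∃[ d ] d < N × Step N x d y
  Step-total x y with toℕ x ≤? toℕ y
  ... | yes x≤y = toℕ y ∸ toℕ x , ≤-<-trans (m∸n≤m (toℕ y) (toℕ x)) (toℕ<n y) , inj₁ (m+[n∸m]≡n x≤y)
  ... | no  x≰y = toℕ y + N ∸ toℕ x , d<N , inj₂ (m+[n∸m]≡n x≤y+N)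
    where
    x≤y+N : toℕ x ≤ toℕ y + N
    x≤y+N = ≤-trans (<⇒≤ (toℕ<n x)) (m≤n+m N (toℕ y))
    d<N : toℕ y + N ∸ toℕ x < N
    d<N = m<n+o⇒m∸n<o _ _ (+-monoˡ-< N (≰⇒> x≰y))

  vertex-reaches : ∀ i y → ∃[ d ] d < N × y ≡ vertex (d + i)
  vertex-reaches i y = let d , d<N , s = Step-total (vertex i) y in d , d<N , Step⇒vertex s

  vertex-centred : ∀ c u → ∃[ b ] u ≡ vertex (c + b)
  vertex-centred c u = let b , _ , u≡ = vertex-reaches c u in b , trans u≡ (cong vertex (+-comm b c))

  vertex-injective-+ : ∀ b {i j} → i < j + N → j < i + N → vertex (i + b) ≡ vertex (j + b) → i ≡ j
  vertex-injective-+ b {i} {j} i<j+N j<i+N e =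
    +-cancelʳ-≡ b i j (vertex-injective (shifted i<j+N) (shifted j<i+N) e)
    where
    shifted : ∀ {m n} → m < n + N → m + b < n + b + N
    shifted {m} {n} m<n+N = subst (m + b <_) (xy∙z≈xz∙y n N b) (+-monoˡ-< b m<n+N)

  Adjacent⇒InClosedNbhd : 3 < N → ∀ b {i j} → Adjacent i j → InClosedNbhd N (vertex (i + b)) (vertex (j + b))
  Adjacent⇒InClosedNbhd 3<N b (inj₁ refl) = inj₁ refl
  Adjacent⇒InClosedNbhd 3<N b {i} (inj₂ (inj₁ refl)) =
    inj₂ (inj₁ (vertex-Step (i + b) (<-trans ≤-lit 3<N)))
  Adjacent⇒InClosedNbhd 3<N b {j = j} (inj₂ (inj₂ (inj₁ refl))) =
    inj₂ (inj₂ (inj₁ (vertex-Step (j + b) (<-trans ≤-lit 3<N))))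
  Adjacent⇒InClosedNbhd 3<N b {i} (inj₂ (inj₂ (inj₂ (inj₁ refl)))) =
    inj₂ (inj₂ (inj₂ (inj₁ (vertex-Step (i + b) 3<N))))
  Adjacent⇒InClosedNbhd 3<N b {j = j} (inj₂ (inj₂ (inj₂ (inj₂ refl)))) =
    inj₂ (inj₂ (inj₂ (inj₂ (vertex-Step (j + b) 3<N))))

  InClosedNbhd⇒Adjacent : ∀ b {i j} → i + 3 < j + N → j + 3 < i + N →
                          InClosedNbhd N (vertex (i + b)) (vertex (j + b)) → Adjacent i j
  InClosedNbhd⇒Adjacent b {i} {j} i≪j j≪i = adjacent
    where
    close : ∀ {m n} c → c ≤ 3 → m + 3 < n + N → c + m < n + N
    close {m} c c≤3 m≪n = ≤-<-trans (subst (c + m ≤_) (+-comm 3 m) (+-monoˡ-≤ m c≤3)) m≪n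
    far : ∀ {m n} c → m + 3 < n + N → m < c + n + N
    far {m} {n} c m≪n = ≤-<-trans (m≤m+n m 3) (<-≤-trans m≪n (+-monoˡ-≤ N (m≤n+m n c)))
    injective : ∀ {m n} → m < n + N → n < m + N → vertex (m + b) ≡ vertex (n + b) → m ≡ n
    injective = vertex-injective-+ b
    adjacent : InClosedNbhd N (vertex (i + b)) (vertex (j + b)) → Adjacent i j
    adjacent (inj₁ e) = inj₁ (injective (close 0 z≤n i≪j) (far 0 j≪i) e)
    adjacent (inj₂ (inj₁ s)) =
      inj₂ (inj₁ (sym (injective (far 1 j≪i) (close 1 ≤-lit i≪j) (Step⇒vertex s))))
    adjacent (inj₂ (inj₂ (inj₁ s))) =
      inj₂ (inj₂ (inj₁ (sym (injective (far 1 i≪j) (close 1 ≤-lit j≪i) (Step⇒vertex s)))))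
    adjacent (inj₂ (inj₂ (inj₂ (inj₁ s)))) =
      inj₂ (inj₂ (inj₂ (inj₁ (sym (injective (far 3 j≪i) (close 3 ≤-refl i≪j) (Step⇒vertex s))))))
    adjacent (inj₂ (inj₂ (inj₂ (inj₂ s)))) =
      inj₂ (inj₂ (inj₂ (inj₂ (sym (injective (far 3 i≪j) (close 3 ≤-refl j≪i) (Step⇒vertex s))))))

  InClosedNbhd-vertex : 3 < N → ∀ b i {w} → InClosedNbhd N (vertex (3 + i + b)) w →
                        ∃[ k ] Adjacent (3 + i) k × w ≡ vertex (k + b)
  InClosedNbhd-vertex 3<N b i (inj₁ refl)                   = 3 + i , inj₁ refl , refl
  InClosedNbhd-vertex 3<N b i (inj₂ (inj₁ s))               = 4 + i , inj₂ (inj₁ refl) , Step⇒vertex s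
  InClosedNbhd-vertex 3<N b i (inj₂ (inj₂ (inj₁ s)))        =
    2 + i , inj₂ (inj₂ (inj₁ refl)) , Step⇒vertex⁻ (<⇒≤ (<-trans ≤-lit 3<N)) s
  InClosedNbhd-vertex 3<N b i (inj₂ (inj₂ (inj₂ (inj₁ s)))) =
    6 + i , inj₂ (inj₂ (inj₂ (inj₁ refl))) , Step⇒vertex s
  InClosedNbhd-vertex 3<N b i (inj₂ (inj₂ (inj₂ (inj₂ s)))) =
    i , inj₂ (inj₂ (inj₂ (inj₂ refl))) , Step⇒vertex⁻ (<⇒≤ 3<N) s

-- A window x lists the code at the offsets k = 0, 1, …, 12 from a base vertex b; its centre
-- is b + 6. Separates x j: a codeword in N[b + 6] lies outside N[b + j]. Only the offsets
-- 3, 5, 6, 7, 9 of N[b + 6] are ever read, so the bits at offsets 3, …, 9 determine a window.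
Separates : (ℕ → Bool) → ℕ → Set
Separates x j = ∃[ k ] Adjacent 6 k × T (x k) × ¬ Adjacent j k

candidateᵇ : (ℕ → Bool) → ℕ → ℕ → Bool
candidateᵇ x j k = ⌊ adjacent? 6 k ⌋ ∧ (x k ∧ not ⌊ adjacent? j k ⌋)

separatesᵇ : (ℕ → Bool) → ℕ → Bool
separatesᵇ x j = anyᵇ< 10 (candidateᵇ x j)

windowOKᵇ : (ℕ → Bool) → Bool
windowOKᵇ x = allᵇ< 13 (λ j → (j ≡ᵇ 6) ∨ separatesᵇ x j)

candidateᵇ-sound : ∀ x j k → T (candidateᵇ x j k) → Adjacent 6 k × T (x k) × ¬ Adjacent j k
candidateᵇ-sound x j k t with adjacent? 6 k | x k | adjacent? j k
... | yes adj | true | no ¬adj = adj , _ , ¬adj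

separatesᵇ-sound : ∀ x j → T (separatesᵇ x j) → Separates x j
separatesᵇ-sound x j t =
  let k , _ , t′ = anyᵇ<-sound 10 {candidateᵇ x j} t in k , candidateᵇ-sound x j k t′

candidateᵇ-complete : ∀ x j k → Adjacent 6 k → T (x k) → ¬ Adjacent j k → T (candidateᵇ x j k)
candidateᵇ-complete x j k adj xk ¬adj with adjacent? 6 k | x k | adjacent? j k
... | yes _ | true | no  _ = _
... | no ¬a | _    | _     = contradiction adj ¬a
... | _     | _    | yes a = contradiction a ¬adj
candidateᵇ-complete x j k adj () ¬adj | yes _ | false | no _

separatesᵇ-complete : ∀ x j → Separates x j → T (separatesᵇ x j)
separatesᵇ-complete x j (k , adj , xk , ¬adj) =
  anyᵇ<-complete {p = candidateᵇ x j} (s≤s (proj₂ (Adjacent-6⇒range adj))) (candidateᵇ-complete x j k adj xk ¬adj)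

windowOKᵇ-sound : ∀ x → T (windowOKᵇ x) → ∀ j → j ≤ 12 → j ≢ 6 → Separates x j
windowOKᵇ-sound x t j j≤12 j≢6
  with to T-∨ (allᵇ<-sound {p = λ j → (j ≡ᵇ 6) ∨ separatesᵇ x j} t (s≤s j≤12))
... | inj₁ j≡6 = contradiction (≡ᵇ⇒≡ j 6 j≡6) j≢6
... | inj₂ sep = separatesᵇ-sound x j sep

windowOKᵇ-complete : ∀ x → (∀ j → j ≤ 12 → j ≢ 6 → Separates x j) → T (windowOKᵇ x)
windowOKᵇ-complete x sep = allᵇ<-complete 13 (λ j j<13 → separated j j<13 (j ≟ 6))
  where
  separated : ∀ j → j < 13 → Dec (j ≡ 6) → T ((j ≡ᵇ 6) ∨ separatesᵇ x j)
  separated .6 _    (yes refl) = _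
  separated j  j<13 (no j≢6)   =
    from (T-∨ {j ≡ᵇ 6} {separatesᵇ x j}) (inj₂ (separatesᵇ-complete x j (sep j (≤-pred j<13) j≢6)))

Separates-transfer : ∀ {x y j} → (∀ {k} → Adjacent 6 k → x k ≡ y k) → Separates x j → Separates y j
Separates-transfer x≗y (k , adj , xk , ¬adj) = k , adj , subst T (x≗y adj) xk , ¬adj

windowOKᵇ-transfer : ∀ x y → (∀ {k} → Adjacent 6 k → x k ≡ y k) → T (windowOKᵇ x) → T (windowOKᵇ y)
windowOKᵇ-transfer x y x≗y t =
  windowOKᵇ-complete y λ j j≤12 j≢6 → Separates-transfer x≗y (windowOKᵇ-sound x t j j≤12 j≢6)

offsets : Bool → Bool → Bool → Bool → Bool → Bool → Bool → ℕ → Bool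
offsets a b c d e f g 3 = a
offsets a b c d e f g 4 = b
offsets a b c d e f g 5 = c
offsets a b c d e f g 6 = d
offsets a b c d e f g 7 = e
offsets a b c d e f g 8 = f
offsets a b c d e f g 9 = g
offsets a b c d e f g _ = false

WindowOKᵇ : Bool → Bool → Bool → Bool → Bool → Bool → Bool → Bool
WindowOKᵇ a b c d e f g = windowOKᵇ (offsets a b c d e f g)

windowAt : (ℕ → Bool) → ℕ → Bool
windowAt s i = WindowOKᵇ (s i) (s (1 + i)) (s (2 + i)) (s (3 + i)) (s (4 + i)) (s (5 + i)) (s (6 + i))

offsets-window : ∀ (s : ℕ → Bool) i {k} → Adjacent 6 k →
  offsets (s (3 + i)) (s (4 + i)) (s (5 + i)) (s (6 + i)) (s (7 + i)) (s (8 + i)) (s (9 + i)) k ≡ s (k + i)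
offsets-window s i (inj₁ refl)                      = refl
offsets-window s i (inj₂ (inj₁ refl))               = refl
offsets-window s i (inj₂ (inj₂ (inj₁ refl)))        = refl
offsets-window s i (inj₂ (inj₂ (inj₂ (inj₁ refl)))) = refl
offsets-window s i (inj₂ (inj₂ (inj₂ (inj₂ refl)))) = refl

windowAt⇔windowOKᵇ : ∀ (s : ℕ → Bool) i → T (windowAt s (3 + i)) ⇔ T (windowOKᵇ (λ k → s (k + i)))
windowAt⇔windowOKᵇ s i = mk⇔ (windowOKᵇ-transfer window shifted (offsets-window s i))
                              (windowOKᵇ-transfer shifted window (sym ∘ offsets-window s i))
  where
  window shifted : ℕ → Bool
  window  = offsets (s (3 + i)) (s (4 + i)) (s (5 + i)) (s (6 + i)) (s (7 + i)) (s (8 + i)) (s (9 + i))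
  shifted = λ k → s (k + i)

∈⇔T-lookup : ∀ {n} {C : Subset n} {x} → x ∈ C ⇔ T (lookup C x)
∈⇔T-lookup {C = C} {x} = mk⇔ (from T-≡ ∘ []=⇒lookup) (lookup⇒[]= x C ∘ to T-≡)

module CodeOnCycle (N : ℕ) .{{_ : NonZero N}} (C : Subset N) where
  open Cycle N

  codeAt : ℕ → Bool
  codeAt i = lookup C (vertex i)

  codeFrom : ℕ → ℕ → Bool
  codeFrom b k = codeAt (k + b)

  Distinguished : Fin N → Fin N → Set
  Distinguished u v = ∃[ w ] w ∈ C × InClosedNbhd N u w × ¬ InClosedNbhd N v w

  selfIdentifying⇒windowOKᵇ : 6 < N → SelfIdentifying N C → ∀ b → T (windowOKᵇ (codeFrom b))
  selfIdentifying⇒windowOKᵇ 6<N (_ , distinguished) b = windowOKᵇ-complete (codeFrom b) separates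
    where
    3<N : 3 < N
    3<N = <-trans ≤-lit 6<N
    separates : ∀ j → j ≤ 12 → j ≢ 6 → Separates (codeFrom b) j
    separates j j≤12 j≢6 =
      let w , w∈C , u∼w , v≁w = distinguished (vertex (6 + b)) (vertex (j + b)) u≢v
          k , 6∼k , w≡ = InClosedNbhd-vertex 3<N b 3 u∼w
      in k , 6∼k , to ∈⇔T-lookup (subst (_∈ C) w≡ w∈C) ,
         λ j∼k → v≁w (subst (InClosedNbhd N (vertex (j + b))) (sym w≡) (Adjacent⇒InClosedNbhd 3<N b j∼k))
      where
      u≢v : vertex (6 + b) ≢ vertex (j + b)
      u≢v e = j≢6 (sym (vertex-injective-+ b (≤-trans 6<N (m≤n+m N j)) (≤-<-trans j≤12 (+-monoʳ-< 6 6<N)) e))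

  windowOKᵇ⇒selfIdentifying : 12 < N → (∀ b → T (windowOKᵇ (codeFrom b))) → SelfIdentifying N C
  windowOKᵇ⇒selfIdentifying 12<N ok = nonempty , distinguished
    where
    separates : ∀ b j → j ≤ 12 → j ≢ 6 → Separates (codeFrom b) j
    separates b = windowOKᵇ-sound (codeFrom b) (ok b)

    witness : ∀ b j k → j < N → Adjacent 6 k → T (codeFrom b k) → ¬ Adjacent j k →
              Distinguished (vertex (6 + b)) (vertex (j + b))
    witness b j k j<N 6∼k k∈C j≁k =
      vertex (k + b) , from ∈⇔T-lookup k∈C , Adjacent⇒InClosedNbhd (<-trans ≤-lit 12<N) b 6∼k ,
      j≁k ∘ InClosedNbhd⇒Adjacent b j+3<k+N k+3<j+N
      where
      j+3<k+N : j + 3 < k + N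
      j+3<k+N = subst (j + 3 <_) (+-comm N k) (+-mono-<-≤ j<N (proj₁ (Adjacent-6⇒range 6∼k)))
      k+3<j+N : k + 3 < j + N
      k+3<j+N = <-≤-trans (≤-<-trans (+-monoˡ-≤ 3 (proj₂ (Adjacent-6⇒range 6∼k))) 12<N) (m≤n+m N j)

    distinguished-offsets : ∀ b j → j < N → j ≢ 6 → Distinguished (vertex (6 + b)) (vertex (j + b))
    distinguished-offsets b j j<N j≢6 with j ≤? 12
    ... | yes j≤12 = let k , 6∼k , k∈C , j≁k = separates b j j≤12 j≢6 in witness b j k j<N 6∼k k∈C j≁k
    ... | no  j≰12 = let k , 6∼k , k∈C , _ = separates b 0 z≤n (λ ()) in witness b j k j<N 6∼k k∈C
      λ j∼k → j≰12 (≤-trans (Adjacent⇒≤3+ j∼k) (+-monoʳ-≤ 3 (proj₂ (Adjacent-6⇒range 6∼k))))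

    nonempty : Nonempty C
    nonempty = let k , _ , k∈C , _ = separates 0 0 z≤n (λ ()) in vertex (k + 0) , from ∈⇔T-lookup k∈C

    distinguished : ∀ u v → u ≢ v → Distinguished u v
    distinguished u v u≢v with vertex-centred 6 u
    ... | b , refl with vertex-reaches b v
    ... | j , j<N , refl = distinguished-offsets b j j<N (u≢v ∘ cong (λ i → vertex (i + b)) ∘ sym)

allVecsᵇ : ∀ n → (Vec Bool n → Bool) → Bool
allVecsᵇ zero    P = P []
allVecsᵇ (suc n) P = allVecsᵇ n (P ∘ (false ∷_)) ∧ allVecsᵇ n (P ∘ (true ∷_))

allVecsᵇ-sound : ∀ n P → T (allVecsᵇ n P) → ∀ w → T (P w)
allVecsᵇ-sound zero    P t []          = t
allVecsᵇ-sound (suc n) P t (false ∷ w) =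
  allVecsᵇ-sound n (P ∘ (false ∷_)) (proj₁ (to (T-∧ {allVecsᵇ n (P ∘ (false ∷_))}) t)) w
allVecsᵇ-sound (suc n) P t (true ∷ w)  =
  allVecsᵇ-sound n (P ∘ (true ∷_)) (proj₂ (to (T-∧ {allVecsᵇ n (P ∘ (false ∷_))}) t)) w

uncurry⁷ : (Bool → Bool → Bool → Bool → Bool → Bool → Bool → Bool) → Vec Bool 7 → Bool
uncurry⁷ P (a ∷ b ∷ c ∷ d ∷ e ∷ f ∷ g ∷ []) = P a b c d e f g

∀⁷ᵇ : (Bool → Bool → Bool → Bool → Bool → Bool → Bool → Bool) → Bool
∀⁷ᵇ P = allVecsᵇ 7 (uncurry⁷ P)

∀⁷ᵇ-sound : ∀ P → T (∀⁷ᵇ P) → ∀ a b c d e f g → T (P a b c d e f g)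
∀⁷ᵇ-sound P t a b c d e f g = allVecsᵇ-sound 7 (uncurry⁷ P) t (a ∷ b ∷ c ∷ d ∷ e ∷ f ∷ g ∷ [])

bitᶠ : Bool → Fin 2
bitᶠ false = Fin.zero
bitᶠ true  = Fin.suc Fin.zero

-- Indexed by six consecutive bits read as a binary number, first bit most significant.
-- Found by computer search; excessBound below is the property it was chosen for.
potentialTable : Vec ℕ 64
potentialTable =
  12 ∷ 12 ∷ 12 ∷ 12 ∷ 12 ∷ 12 ∷ 12 ∷  9 ∷
  12 ∷ 12 ∷ 12 ∷ 12 ∷  8 ∷ 12 ∷  8 ∷ 12 ∷
  12 ∷ 12 ∷ 12 ∷ 12 ∷ 12 ∷ 12 ∷ 12 ∷ 12 ∷
   4 ∷ 11 ∷  8 ∷ 12 ∷  4 ∷ 11 ∷  8 ∷ 12 ∷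
  12 ∷ 12 ∷ 12 ∷  6 ∷ 12 ∷ 12 ∷ 12 ∷ 12 ∷
  12 ∷ 12 ∷ 12 ∷ 12 ∷  8 ∷ 12 ∷  8 ∷ 12 ∷
  12 ∷  3 ∷ 12 ∷ 10 ∷ 12 ∷ 10 ∷ 12 ∷ 12 ∷
   0 ∷  7 ∷  7 ∷ 12 ∷  4 ∷ 11 ∷  8 ∷ 12 ∷ []

potential : Bool → Bool → Bool → Bool → Bool → Bool → ℕ
potential a b c d e f = lookup potentialTable
  (combine (bitᶠ a) (combine (bitᶠ b) (combine (bitᶠ c) (combine (bitᶠ d) (combine (bitᶠ e) (bitᶠ f))))))

excess : Bool → Bool → Bool → Bool → Bool → Bool → Bool → ℕ
excess a b c d e f g = 7 * bit g + potential a b c d e f ∸ (4 + potential b c d e f g)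

excessBoundᵇ : Bool → Bool → Bool → Bool → Bool → Bool → Bool → Bool
excessBoundᵇ a b c d e f g =
  WindowOKᵇ a b c d e f g ⇒ᵇ (4 + potential b c d e f g ≤ᵇ 7 * bit g + potential a b c d e f)

-- accumulatesᵇ m acc a b c d e f: however the bits a … f are continued by m further bits
-- with valid windows, acc plus the excesses of those m windows reaches 3.
accumulatesᵇ : ℕ → ℕ → Bool → Bool → Bool → Bool → Bool → Bool → Bool
continuesᵇ : ℕ → ℕ → Bool → Bool → Bool → Bool → Bool → Bool → Bool → Bool

accumulatesᵇ zero    acc a b c d e f = 3 ≤ᵇ acc
accumulatesᵇ (suc m) acc a b c d e f =
  (3 ≤ᵇ acc) ∨ (continuesᵇ m acc a b c d e f false ∧ continuesᵇ m acc a b c d e f true)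

continuesᵇ m acc a b c d e f g =
  WindowOKᵇ a b c d e f g ⇒ᵇ accumulatesᵇ m (acc + excess a b c d e f g) b c d e f g

excessSpreadsᵇ : Bool → Bool → Bool → Bool → Bool → Bool → Bool → Bool
excessSpreadsᵇ a b c d e f g =
  WindowOKᵇ a b c d e f g ⇒ᵇ ((excess a b c d e f g ≡ᵇ 0) ∨ accumulatesᵇ 11 (excess a b c d e f g) b c d e f g)

excessBound : T (∀⁷ᵇ excessBoundᵇ)
excessBound = _

excessSpreads : T (∀⁷ᵇ excessSpreadsᵇ)
excessSpreads = _

excess-identity : ∀ a b c d e f g → T (WindowOKᵇ a b c d e f g) →
                  7 * bit g + potential a b c d e f ≡ excess a b c d e f g + (4 + potential b c d e f g)
excess-identity a b c d e f g ok =
  sym (m∸n+n≡m (≤ᵇ⇒≤ _ _ (⇒ᵇ-mp (WindowOKᵇ a b c d e f g) bound ok)))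
  where
  bound : T (excessBoundᵇ a b c d e f g)
  bound = ∀⁷ᵇ-sound excessBoundᵇ excessBound a b c d e f g

excess-spreads-window : ∀ a b c d e f g → T (WindowOKᵇ a b c d e f g) →
  T ((excess a b c d e f g ≡ᵇ 0) ∨ accumulatesᵇ 11 (excess a b c d e f g) b c d e f g)
excess-spreads-window a b c d e f g =
  ⇒ᵇ-mp (WindowOKᵇ a b c d e f g) (∀⁷ᵇ-sound excessSpreadsᵇ excessSpreads a b c d e f g)

∧-both : ∀ (p : Bool → Bool) → T (p false ∧ p true) → ∀ x → T (p x)
∧-both p t false = proj₁ (to (T-∧ {p false}) t)
∧-both p t true  = proj₂ (to (T-∧ {p false}) t)

module Discharging (n : ℕ) (s : ℕ → Bool) (periodic : ∀ i → s (i + n) ≡ s i)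
                   (valid : ∀ i → T (windowAt s i)) where

  ψ : ℕ → ℕ
  ψ i = potential (s i) (s (1 + i)) (s (2 + i)) (s (3 + i)) (s (4 + i)) (s (5 + i))

  ε : ℕ → ℕ
  ε i = excess (s i) (s (1 + i)) (s (2 + i)) (s (3 + i)) (s (4 + i)) (s (5 + i)) (s (6 + i))

  ψ-periodic : ∀ i → ψ (i + n) ≡ ψ i
  ψ-periodic i rewrite periodic i | periodic (1 + i) | periodic (2 + i) | periodic (3 + i)
                     | periodic (4 + i) | periodic (5 + i) = refl

  ε-periodic : ∀ i → ε (i + n) ≡ ε i
  ε-periodic i rewrite periodic i | periodic (1 + i) | periodic (2 + i) | periodic (3 + i)
                     | periodic (4 + i) | periodic (5 + i) | periodic (6 + i) = refl

  charge : ∀ i → 7 * bit (s (6 + i)) + ψ i ≡ ε i + (4 + ψ (1 + i))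
  charge i = excess-identity (s i) (s (1 + i)) (s (2 + i)) (s (3 + i)) (s (4 + i)) (s (5 + i)) (s (6 + i)) (valid i)

  charge-balance : 7 * ∑< n (bit ∘ s) ≡ ∑< n ε + 4 * n
  charge-balance = +-cancelʳ-≡ (∑< n ψ) _ _ (begin
    7 * ∑< n (bit ∘ s) + ∑< n ψ                         ≡⟨ cong (λ t → 7 * t + ∑< n ψ) (∑<-rotate n (bit ∘ s) (cong bit ∘ periodic) 6) ⟨
    7 * ∑< n (λ i → bit (s (6 + i))) + ∑< n ψ           ≡⟨ cong (_+ ∑< n ψ) (∑<-*ˡ n 7 _) ⟨
    ∑< n (λ i → 7 * bit (s (6 + i))) + ∑< n ψ           ≡⟨ ∑<-+ n _ ψ ⟨
    ∑< n (λ i → 7 * bit (s (6 + i)) + ψ i)              ≡⟨ ∑<-cong n (λ i _ → charge i) ⟩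
    ∑< n (λ i → ε i + (4 + ψ (1 + i)))                  ≡⟨ ∑<-+ n ε _ ⟩
    ∑< n ε + ∑< n (λ i → 4 + ψ (1 + i))                 ≡⟨ cong (∑< n ε +_) (∑<-+ n (λ _ → 4) _) ⟩
    ∑< n ε + (∑< n (λ _ → 4) + ∑< n (λ i → ψ (1 + i)))  ≡⟨ cong (∑< n ε +_) (cong₂ _+_ (∑<-const n 4) (∑<-rotate n ψ ψ-periodic 1)) ⟩
    ∑< n ε + (4 * n + ∑< n ψ)                           ≡⟨ +-assoc (∑< n ε) _ _ ⟨
    ∑< n ε + 4 * n + ∑< n ψ                             ∎)
    where open ≡-Reasoning

  accumulatesᵇ-sound : ∀ m acc p →
    T (accumulatesᵇ m acc (s (1 + p)) (s (2 + p)) (s (3 + p)) (s (4 + p)) (s (5 + p)) (s (6 + p))) →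
    3 ≤ acc + ∑< m (λ i → ε (i + suc p))
  accumulatesᵇ-sound zero    acc p t = ≤-trans (≤ᵇ⇒≤ 3 acc t) (m≤m+n acc 0)
  accumulatesᵇ-sound (suc m) acc p t with to (T-∨ {3 ≤ᵇ acc}) t
  ... | inj₁ 3≤acc = ≤-trans (≤ᵇ⇒≤ 3 acc 3≤acc) (m≤m+n acc _)
  ... | inj₂ t′    = ≤-trans (accumulatesᵇ-sound m (acc + ε (suc p)) (suc p) next) (≤-reflexive regroup)
    where
    next : T (accumulatesᵇ m (acc + ε (suc p)) (s (2 + p)) (s (3 + p)) (s (4 + p)) (s (5 + p)) (s (6 + p)) (s (7 + p)))
    next = ⇒ᵇ-mp (windowAt s (suc p))
      (∧-both (continuesᵇ m acc (s (1 + p)) (s (2 + p)) (s (3 + p)) (s (4 + p)) (s (5 + p)) (s (6 + p))) t′ (s (7 + p)))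
      (valid (suc p))
    regroup : acc + ε (suc p) + ∑< m (λ i → ε (i + suc (suc p)))
            ≡ acc + (ε (suc p) + ∑< m (λ i → ε (suc i + suc p)))
    regroup = trans (+-assoc acc (ε (suc p)) _)
                    (cong (λ t → acc + (ε (suc p) + t)) (∑<-cong m (λ i _ → cong ε (+-suc i (suc p)))))

  excess-spreads : ∀ j → ε j ≢ 0 → 3 ≤ ∑< 12 (λ i → ε (i + j))
  excess-spreads j ε≢0
    with to T-∨
            (excess-spreads-window (s j) (s (1 + j)) (s (2 + j)) (s (3 + j)) (s (4 + j)) (s (5 + j)) (s (6 + j)) (valid j))
  ... | inj₁ ε≡0 = contradiction (≡ᵇ⇒≡ (ε j) 0 ε≡0) ε≢0
  ... | inj₂ t   = ≤-trans (accumulatesᵇ-sound 11 (ε j) j t)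
                           (≤-reflexive (cong (ε j +_) (∑<-cong 11 (λ i _ → cong ε (+-suc i j)))))

  count-dichotomy : 12 ≤ n → 7 * ∑< n (bit ∘ s) ≡ 4 * n ⊎ 4 * n + 3 ≤ 7 * ∑< n (bit ∘ s)
  count-dichotomy 12≤n with ∑< n ε ≟ 0
  ... | yes ∑ε≡0 = inj₁ (trans charge-balance (cong (_+ 4 * n) ∑ε≡0))
  ... | no  ∑ε≢0 = let j , _ , εj≢0 = ∑<-nonzero n ε ∑ε≢0 in inj₂ (begin
    4 * n + 3                 ≡⟨ +-comm (4 * n) 3 ⟩
    3 + 4 * n                 ≤⟨ +-monoˡ-≤ (4 * n) (three-le j εj≢0) ⟩
    ∑< n ε + 4 * n            ≡⟨ charge-balance ⟨
    7 * ∑< n (bit ∘ s)        ∎)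
    where
    open ≤-Reasoning
    three-le : ∀ j → ε j ≢ 0 → 3 ≤ ∑< n ε
    three-le j εj≢0 = begin
      3                          ≤⟨ excess-spreads j εj≢0 ⟩
      ∑< 12 (λ i → ε (i + j))    ≤⟨ ∑<-mono _ 12≤n ⟩
      ∑< n (λ i → ε (i + j))     ≡⟨ ∑<-cong n (λ i _ → cong ε (+-comm i j)) ⟩
      ∑< n (λ i → ε (j + i))     ≡⟨ ∑<-rotate n ε ε-periodic j ⟩
      ∑< n ε                     ∎

at : List Bool → ℕ → Bool
at []       _       = false
at (x ∷ xs) zero    = x
at (x ∷ xs) (suc i) = at xs i

∣∣≡∑<-at : ∀ {n} (C : Subset n) → ∣ C ∣ ≡ ∑< n (bit ∘ at (toList C))
∣∣≡∑<-at []          = refl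
∣∣≡∑<-at (true  ∷ C) = cong suc (∣∣≡∑<-at C)
∣∣≡∑<-at (false ∷ C) = ∣∣≡∑<-at C

lookup≡at : ∀ {n} (C : Vec Bool n) x → lookup C x ≡ at (toList C) (toℕ x)
lookup≡at (b ∷ C) Fin.zero    = refl
lookup≡at (b ∷ C) (Fin.suc x) = lookup≡at C x

module CodeCount (N : ℕ) .{{_ : NonZero N}} (C : Subset N) where
  open Cycle N
  open CodeOnCycle N C

  ∣C∣≡∑<codeAt : ∣ C ∣ ≡ ∑< N (bit ∘ codeAt)
  ∣C∣≡∑<codeAt = trans (∣∣≡∑<-at C) (∑<-cong N λ i i<N → cong bit (sym (begin
    lookup C (vertex i)                ≡⟨ lookup≡at C (vertex i) ⟩
    at (toList C) (toℕ (vertex i))     ≡⟨ cong (at (toList C)) (trans (toℕ-vertex i) (m<n⇒m%n≡m i<N)) ⟩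
    at (toList C) i                    ∎)))
    where open ≡-Reasoning

  count-dichotomy : 12 ≤ N → SelfIdentifying N C → 7 * ∣ C ∣ ≡ 4 * N ⊎ 4 * N + 3 ≤ 7 * ∣ C ∣
  count-dichotomy 12≤N sid = subst (λ c → 7 * c ≡ 4 * N ⊎ 4 * N + 3 ≤ 7 * c) (sym ∣C∣≡∑<shifted)
                                   (Discharging.count-dichotomy N shifted shifted-periodic valid 12≤N)
    where
    shifted : ℕ → Bool
    shifted i = codeAt (3 + i)
    codeAt-periodic : ∀ i → codeAt (i + N) ≡ codeAt i
    codeAt-periodic i = cong (lookup C) (vertex-periodic i)
    shifted-periodic : ∀ i → shifted (i + N) ≡ shifted i
    shifted-periodic i = codeAt-periodic (3 + i)
    valid : ∀ i → T (windowAt shifted i)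
    valid i = from (windowAt⇔windowOKᵇ codeAt i) (selfIdentifying⇒windowOKᵇ (≤-trans ≤-lit 12≤N) sid i)
    ∣C∣≡∑<shifted : ∣ C ∣ ≡ ∑< N (bit ∘ shifted)
    ∣C∣≡∑<shifted = trans ∣C∣≡∑<codeAt (sym (∑<-rotate N (bit ∘ codeAt) (cong bit ∘ codeAt-periodic) 3))

[4*[7*k+r]]%7≡[4*r]%7 : ∀ k r → 4 * (7 * k + r) % 7 ≡ 4 * r % 7
[4*[7*k+r]]%7≡[4*r]%7 k r = trans (cong (_% 7) (regroup k r)) ([m+kn]%n≡m%n (4 * r) (4 * k) 7)
  where
  regroup : ∀ k r → 4 * (7 * k + r) ≡ 4 * r + 4 * k * 7
  regroup = solve-∀

7*x≡4*[7*k+r]⇒r≡0 : ∀ x k r → r ≤ 6 → 7 * x ≡ 4 * (7 * k + r) → r ≡ 0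
7*x≡4*[7*k+r]⇒r≡0 x k r r≤6 e = residue-zero r r≤6 (begin
  4 * r % 7              ≡⟨ [4*[7*k+r]]%7≡[4*r]%7 k r ⟨
  4 * (7 * k + r) % 7    ≡⟨ cong (_% 7) (trans (sym e) (*-comm 7 x)) ⟩
  x * 7 % 7              ≡⟨ m*n%n≡0 x 7 ⟩
  0                      ∎)
  where
  open ≡-Reasoning
  residue-zero : ∀ r → r ≤ 6 → 4 * r % 7 ≡ 0 → r ≡ 0
  residue-zero 0 _ _ = refl
  residue-zero 1 _ ()
  residue-zero 2 _ ()
  residue-zero 3 _ ()
  residue-zero 4 _ ()
  residue-zero 5 _ ()
  residue-zero 6 _ ()
  residue-zero (suc (suc (suc (suc (suc (suc (suc _))))))) (s≤s (s≤s (s≤s (s≤s (s≤s (s≤s ())))))) _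

sidValue-split : ∀ k r → r ≤ 6 → sidValue k r ≡ 4 * k + sidValue 0 r
sidValue-split k 0 _ = sym (+-identityʳ (4 * k))
sidValue-split k 1 _ = refl
sidValue-split k 2 _ = refl
sidValue-split k 3 _ = refl
sidValue-split k 4 _ = refl
sidValue-split k 5 _ = refl
sidValue-split k 6 _ = refl
sidValue-split k (suc (suc (suc (suc (suc (suc (suc _))))))) (s≤s (s≤s (s≤s (s≤s (s≤s (s≤s ()))))))

7*sidValue≤4*[7*k+r]+9 : ∀ k r → r ≤ 6 → 7 * sidValue k r ≤ 4 * (7 * k + r) + 9
7*sidValue≤4*[7*k+r]+9 k r r≤6 = begin
  7 * sidValue k r                  ≡⟨ cong (7 *_) (sidValue-split k r r≤6) ⟩
  7 * (4 * k + sidValue 0 r)        ≡⟨ expand k (sidValue 0 r) ⟩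
  28 * k + 7 * sidValue 0 r         ≤⟨ +-monoʳ-≤ (28 * k) (offset-bound r r≤6) ⟩
  28 * k + (4 * r + 9)              ≡⟨ regroup k r ⟩
  4 * (7 * k + r) + 9               ∎
  where
  open ≤-Reasoning
  expand : ∀ k c → 7 * (4 * k + c) ≡ 28 * k + 7 * c
  expand = solve-∀
  regroup : ∀ k r → 28 * k + (4 * r + 9) ≡ 4 * (7 * k + r) + 9
  regroup = solve-∀
  offset-bound : ∀ r → r ≤ 6 → 7 * sidValue 0 r ≤ 4 * r + 9
  offset-bound 0 _ = ≤-lit
  offset-bound 1 _ = ≤-lit
  offset-bound 2 _ = ≤-lit
  offset-bound 3 _ = ≤-lit
  offset-bound 4 _ = ≤-lit
  offset-bound 5 _ = ≤-lit
  offset-bound 6 _ = ≤-lit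
  offset-bound (suc (suc (suc (suc (suc (suc (suc _))))))) (s≤s (s≤s (s≤s (s≤s (s≤s (s≤s ()))))))

sidValue-minimal : ∀ k r x → r ≤ 6 →
  7 * x ≡ 4 * (7 * k + r) ⊎ 4 * (7 * k + r) + 3 ≤ 7 * x → sidValue k r ≤ x
sidValue-minimal k r x r≤6 (inj₁ e) with 7*x≡4*[7*k+r]⇒r≡0 x k r r≤6 e
... | refl = ≤-reflexive (*-cancelˡ-≡ (4 * k) x 7 (begin
  7 * (4 * k)        ≡⟨ regroup k ⟩
  4 * (7 * k + 0)    ≡⟨ e ⟨
  7 * x              ∎))
  where
  open ≡-Reasoning
  regroup : ∀ k → 7 * (4 * k) ≡ 4 * (7 * k + 0)
  regroup = solve-∀
sidValue-minimal k r x r≤6 (inj₂ h) = s≤s⁻¹ (*-cancelˡ-< 7 (sidValue k r) (suc x) (begin-strict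
  7 * sidValue k r          ≤⟨ 7*sidValue≤4*[7*k+r]+9 k r r≤6 ⟩
  4 * (7 * k + r) + 9       ≡⟨ +-assoc (4 * (7 * k + r)) 3 6 ⟨
  4 * (7 * k + r) + 3 + 6   ≤⟨ +-monoˡ-≤ 6 h ⟩
  7 * x + 6                 <⟨ +-monoʳ-< (7 * x) ≤-refl ⟩
  7 * x + 7                 ≡⟨ +-comm (7 * x) 7 ⟩
  7 + 7 * x                 ≡⟨ *-suc 7 x ⟨
  7 * suc x                 ∎))
  where open ≤-Reasoning

ones : List Bool → ℕ
ones []       = 0
ones (x ∷ xs) = bit x + ones xs

∣fromList∣≡ones : ∀ L → ∣ fromList L ∣ ≡ ones L
∣fromList∣≡ones []          = refl
∣fromList∣≡ones (true  ∷ L) = cong suc (∣fromList∣≡ones L)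
∣fromList∣≡ones (false ∷ L) = ∣fromList∣≡ones L

ones-++ : ∀ xs ys → ones (xs ++ ys) ≡ ones xs + ones ys
ones-++ []       ys = refl
ones-++ (x ∷ xs) ys = trans (cong (bit x +_) (ones-++ xs ys)) (sym (+-assoc (bit x) _ _))

at-++ˡ : ∀ xs ys {i} → i < length xs → at (xs ++ ys) i ≡ at xs i
at-++ˡ (x ∷ xs) ys {zero}  _         = refl
at-++ˡ (x ∷ xs) ys {suc i} (s≤s i<n) = at-++ˡ xs ys i<n

at-++ʳ : ∀ xs ys i → at (xs ++ ys) (length xs + i) ≡ at ys i
at-++ʳ []       ys i = refl
at-++ʳ (x ∷ xs) ys i = at-++ʳ xs ys i

at-take : ∀ m xs {i} → i < m → at (take m xs) i ≡ at xs i
at-take (suc m) []       _         = refl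
at-take (suc m) (x ∷ xs) {zero}  _ = refl
at-take (suc m) (x ∷ xs) {suc i} (s≤s i<m) = at-take m xs i<m

WindowOKᵇ-cong : ∀ {a b c d e f g a′ b′ c′ d′ e′ f′ g′} →
                 a ≡ a′ → b ≡ b′ → c ≡ c′ → d ≡ d′ → e ≡ e′ → f ≡ f′ → g ≡ g′ →
                 WindowOKᵇ a b c d e f g ≡ WindowOKᵇ a′ b′ c′ d′ e′ f′ g′
WindowOKᵇ-cong refl refl refl refl refl refl refl = refl

windowAt-cong : ∀ s t i j → (∀ k → k ≤ 6 → s (k + i) ≡ t (k + j)) → windowAt s i ≡ windowAt t j
windowAt-cong s t i j e =
  WindowOKᵇ-cong (e 0 z≤n) (e 1 ≤-lit) (e 2 ≤-lit) (e 3 ≤-lit) (e 4 ≤-lit) (e 5 ≤-lit) (e 6 ≤-lit)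

windowsᵇ : List Bool → Bool
windowsᵇ (a ∷ b ∷ c ∷ d ∷ e ∷ f ∷ g ∷ w) = WindowOKᵇ a b c d e f g ∧ windowsᵇ (b ∷ c ∷ d ∷ e ∷ f ∷ g ∷ w)
windowsᵇ _                               = true

windowsᵇ-sound : ∀ w i → T (windowsᵇ w) → 7 + i ≤ length w → T (windowAt (at w) i)
windowsᵇ-sound (a ∷ b ∷ c ∷ d ∷ e ∷ f ∷ g ∷ w) zero    t _ = proj₁ (to (T-∧ {WindowOKᵇ a b c d e f g}) t)
windowsᵇ-sound (a ∷ b ∷ c ∷ d ∷ e ∷ f ∷ g ∷ w) (suc i) t (s≤s le) =
  windowsᵇ-sound (b ∷ c ∷ d ∷ e ∷ f ∷ g ∷ w) i (proj₂ (to (T-∧ {WindowOKᵇ a b c d e f g}) t)) le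
windowsᵇ-sound []                          i t ()
windowsᵇ-sound (_ ∷ [])                    i t (s≤s ())
windowsᵇ-sound (_ ∷ _ ∷ [])                i t (s≤s (s≤s ()))
windowsᵇ-sound (_ ∷ _ ∷ _ ∷ [])            i t (s≤s (s≤s (s≤s ())))
windowsᵇ-sound (_ ∷ _ ∷ _ ∷ _ ∷ [])        i t (s≤s (s≤s (s≤s (s≤s ()))))
windowsᵇ-sound (_ ∷ _ ∷ _ ∷ _ ∷ _ ∷ [])    i t (s≤s (s≤s (s≤s (s≤s (s≤s ())))))
windowsᵇ-sound (_ ∷ _ ∷ _ ∷ _ ∷ _ ∷ _ ∷ []) i t (s≤s (s≤s (s≤s (s≤s (s≤s (s≤s ()))))))

module _ (L : List Bool) .{{_ : NonZero (length L)}} where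

  at-cyclic : 6 ≤ length L → ∀ {j} → j < length L + 6 → at (L ++ take 6 L) j ≡ at L (j % length L)
  at-cyclic 6≤N {j} j<N+6 with j <? length L
  ... | yes j<N = trans (at-++ˡ L (take 6 L) j<N) (cong (at L) (sym (m<n⇒m%n≡m j<N)))
  ... | no  j≮N = begin
    at (L ++ take 6 L) j                      ≡⟨ cong (at (L ++ take 6 L)) j≡ ⟨
    at (L ++ take 6 L) (length L + t)         ≡⟨ at-++ʳ L (take 6 L) t ⟩
    at (take 6 L) t                           ≡⟨ at-take 6 L t<6 ⟩
    at L t                                    ≡⟨ cong (at L) (m<n⇒m%n≡m (<-≤-trans t<6 6≤N)) ⟨
    at L (t % length L)                       ≡⟨ cong (at L) ([m+n]%n≡m%n t (length L)) ⟨
    at L ((t + length L) % length L)          ≡⟨ cong (λ i → at L (i % length L)) (trans (+-comm t _) j≡) ⟩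
    at L (j % length L)                       ∎
    where
    open ≡-Reasoning
    t : ℕ
    t = j ∸ length L
    j≡ : length L + t ≡ j
    j≡ = m+[n∸m]≡n (≮⇒≥ j≮N)
    t<6 : t < 6
    t<6 = m<n+o⇒m∸n<o j (length L) j<N+6

  fromWord-selfIdentifying : 12 < length L → T (windowsᵇ (L ++ take 6 L)) → SelfIdentifying (length L) (fromList L)
  fromWord-selfIdentifying 12<N t =
    windowOKᵇ⇒selfIdentifying 12<N (λ b → to (windowAt⇔windowOKᵇ codeAt b) (windows (3 + b)))
    where
    N : ℕ
    N = length L
    open CodeOnCycle N (fromList L)
    open Cycle N using (vertex; toℕ-vertex)
    6≤N : 6 ≤ N
    6≤N = ≤-trans ≤-lit (<⇒≤ 12<N)
    codeAt≡at : ∀ i → codeAt i ≡ at L (i % N)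
    codeAt≡at i = begin
      lookup (fromList L) (vertex i)              ≡⟨ lookup≡at (fromList L) (vertex i) ⟩
      at (toList (fromList L)) (toℕ (vertex i))   ≡⟨ cong₂ at (toList∘fromList L) (toℕ-vertex i) ⟩
      at L (i % N)                                ∎
      where open ≡-Reasoning
    w : List Bool
    w = L ++ take 6 L
    windows : ∀ i → T (windowAt codeAt i)
    windows i = subst T (windowAt-cong (at w) codeAt (i % N) i agree) (windowsᵇ-sound w (i % N) t bound)
      where
      bound : 7 + i % N ≤ length w
      bound = begin
        7 + i % N       ≡⟨ +-comm 7 (i % N) ⟩
        i % N + 7       ≡⟨ +-suc (i % N) 6 ⟩
        suc (i % N) + 6 ≤⟨ +-monoˡ-≤ 6 (m%n<n i N) ⟩
        N + 6           ≡⟨ cong (N +_) (trans (length-take 6 L) (m≤n⇒m⊓n≡m 6≤N)) ⟨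
        N + length (take 6 L) ≡⟨ length-++ L ⟨
        length w        ∎
        where open ≤-Reasoning
      agree : ∀ k → k ≤ 6 → at w (k + i % N) ≡ codeAt (k + i)
      agree k k≤6 = begin
        at w (k + i % N)            ≡⟨ at-cyclic 6≤N (subst (k + i % N <_) (+-comm 6 N) (+-mono-≤-< k≤6 (m%n<n i N))) ⟩
        at L ((k + i % N) % N)      ≡⟨ cong (at L) ([m+n%d]%d≡[m+n]%d k i N) ⟩
        at L ((k + i) % N)          ≡⟨ codeAt≡at (k + i) ⟨
        codeAt (k + i)              ∎
        where open ≡-Reasoning

blocks : List Bool → ℕ → List Bool → List Bool
blocks B zero    tail = tail
blocks B (suc k) tail = B ++ blocks B k tail

length-blocks : ∀ B k tail → length (blocks B k tail) ≡ k * length B + length tail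
length-blocks B zero    tail = refl
length-blocks B (suc k) tail =
  trans (length-++ B) (trans (cong (length B +_) (length-blocks B k tail)) (sym (+-assoc (length B) _ _)))

ones-blocks : ∀ B k tail → ones (blocks B k tail) ≡ k * ones B + ones tail
ones-blocks B zero    tail = refl
ones-blocks B (suc k) tail =
  trans (ones-++ B _) (trans (cong (ones B +_) (ones-blocks B k tail)) (sym (+-assoc (ones B) _ _)))

SelfIdentifyingCode : ℕ → ℕ → Set
SelfIdentifyingCode n m = Σ[ C ∈ Subset n ] SelfIdentifying n C × ∣ C ∣ ≡ m

fromWord : ∀ {n} L → n ≡ length L → 12 < n → T (windowsᵇ (L ++ take 6 L)) → SelfIdentifyingCode n (ones L)
fromWord L refl 12<n t = fromList L , fromWord-selfIdentifying L {{>-nonZero (<-trans z<s 12<n)}} 12<n t , ∣fromList∣≡ones L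

module PeriodicWord (a b c d e f g : Bool)
  (rotations : ∀ X → windowsᵇ (b ∷ c ∷ d ∷ e ∷ f ∷ g ∷ a ∷ b ∷ c ∷ d ∷ e ∷ f ∷ g ∷ X)
                   ≡ windowsᵇ (b ∷ c ∷ d ∷ e ∷ f ∷ g ∷ X)) where

  block : List Bool
  block = a ∷ b ∷ c ∷ d ∷ e ∷ f ∷ g ∷ []

  word-windows : ∀ k tail → T (WindowOKᵇ a b c d e f g) →
    T (windowsᵇ (b ∷ c ∷ d ∷ e ∷ f ∷ g ∷ tail ++ a ∷ b ∷ c ∷ d ∷ e ∷ f ∷ [])) →
    T (windowsᵇ (blocks block (suc k) tail ++ take 6 (blocks block (suc k) tail)))
  word-windows k tail first closing = from T-∧ (first , subst T (sym (absorb k)) closing)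
    where
    absorb : ∀ k → windowsᵇ (b ∷ c ∷ d ∷ e ∷ f ∷ g ∷ blocks block k tail ++ a ∷ b ∷ c ∷ d ∷ e ∷ f ∷ [])
                 ≡ windowsᵇ (b ∷ c ∷ d ∷ e ∷ f ∷ g ∷ tail ++ a ∷ b ∷ c ∷ d ∷ e ∷ f ∷ [])
    absorb zero    = refl
    absorb (suc k) = trans (rotations (blocks block k tail ++ a ∷ b ∷ c ∷ d ∷ e ∷ f ∷ [])) (absorb k)

  code : ∀ {n k r} tail → r ≡ length tail → n ≡ 7 * suc k + r → 12 < n → T (WindowOKᵇ a b c d e f g) →
    T (windowsᵇ (b ∷ c ∷ d ∷ e ∷ f ∷ g ∷ tail ++ a ∷ b ∷ c ∷ d ∷ e ∷ f ∷ [])) →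
    SelfIdentifyingCode n (ones block * suc k + ones tail)
  code {n} {k} tail refl n≡ 12<n first closing
    with fromWord (blocks block (suc k) tail) length≡ 12<n (word-windows k tail first closing)
    where
    length≡ : n ≡ length (blocks block (suc k) tail)
    length≡ = trans n≡ (trans (cong (_+ length tail) (*-comm 7 (suc k))) (sym (length-blocks block (suc k) tail)))
  ... | C , sid , ∣C∣≡ =
    C , sid , trans ∣C∣≡ (trans (ones-blocks block (suc k) tail) (cong (_+ ones tail) (*-comm (suc k) _)))

step? : ∀ n u d v → Dec (Step n u d v)
step? n u d v = toℕ u + d ≟ toℕ v ⊎-dec toℕ u + d ≟ toℕ v + n

inClosedNbhd? : ∀ n u v → Dec (InClosedNbhd n u v)
inClosedNbhd? n u v = u ≟ᶠ v ⊎-dec step? n u 1 v ⊎-dec step? n v 1 u ⊎-dec step? n u 3 v ⊎-dec step? n v 3 u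

selfIdentifying? : ∀ n C → Dec (SelfIdentifying n C)
selfIdentifying? n C = nonempty? C ×-dec all? λ u → all? λ v → ¬? (u ≟ᶠ v) →-dec
  any? λ w → w ∈? C ×-dec inClosedNbhd? n u w ×-dec ¬? (inClosedNbhd? n v w)

-- The periodic words for n = 12 fall below the range of windowOKᵇ⇒selfIdentifying.
code₁₂ : Subset 12
code₁₂ = true ∷ true ∷ true ∷ true ∷ true ∷ false ∷ false ∷ true ∷ true ∷ true ∷ false ∷ false ∷ []

code₁₂-selfIdentifying : SelfIdentifying 12 code₁₂
code₁₂-selfIdentifying = from-yes (selfIdentifying? 12 code₁₂)

-- No tail of length 4 with three ones can follow the block 0001111; its rotation 0011110 can.
module Block₁ = PeriodicWord false false false true true true true (λ _ → refl)
module Block₂ = PeriodicWord false false true true true true false (λ _ → refl)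

periodic-upper-bound : ∀ n k r → 12 < n → r ≤ 6 → n ≡ 7 * k + r → SelfIdentifyingCode n (sidValue k r)
periodic-upper-bound n zero    r 12<n r≤6 n≡ = contradiction (≤-trans (subst (12 <_) n≡ 12<n) r≤6) (<⇒≱ ≤-lit)
periodic-upper-bound n (suc k) r 12<n r≤6 n≡ =
  subst (SelfIdentifyingCode n) (sym (sidValue-split (suc k) r r≤6)) (word r r≤6 n≡)
  where
  word : ∀ r → r ≤ 6 → n ≡ 7 * suc k + r → SelfIdentifyingCode n (4 * suc k + sidValue 0 r)
  word 0 _ n≡ = Block₁.code [] refl n≡ 12<n _ _
  word 1 _ n≡ = Block₁.code (true ∷ []) refl n≡ 12<n _ _
  word 2 _ n≡ = Block₁.code (true ∷ true ∷ []) refl n≡ 12<n _ _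
  word 3 _ n≡ = Block₁.code (true ∷ true ∷ true ∷ []) refl n≡ 12<n _ _
  word 4 _ n≡ = Block₂.code (false ∷ true ∷ true ∷ true ∷ []) refl n≡ 12<n _ _
  word 5 _ n≡ = Block₁.code (false ∷ true ∷ true ∷ true ∷ true ∷ []) refl n≡ 12<n _ _
  word 6 _ n≡ = Block₁.code (false ∷ false ∷ true ∷ true ∷ true ∷ true ∷ []) refl n≡ 12<n _ _
  word (suc (suc (suc (suc (suc (suc (suc _))))))) r≤6 _ = contradiction r≤6 (<⇒≱ ≤-lit)

12≡7*k+r⇒k≡1×r≡5 : ∀ k r → r ≤ 6 → 12 ≡ 7 * k + r → k ≡ 1 × r ≡ 5
12≡7*k+r⇒k≡1×r≡5 0 r r≤6 12≡r = contradiction (subst (_≤ 6) (sym 12≡r) r≤6) (<⇒≱ ≤-lit)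
12≡7*k+r⇒k≡1×r≡5 1 5 _ refl = refl , refl
12≡7*k+r⇒k≡1×r≡5 (suc (suc k)) r _ 12≡n =
  contradiction (subst (14 ≤_) (trans (sym (expand k r)) (sym 12≡n)) (m≤m+n 14 (7 * k + r))) (<⇒≱ ≤-lit)
  where
  expand : ∀ k r → 7 * (2 + k) + r ≡ 14 + (7 * k + r)
  expand = solve-∀

upper-bound : ∀ n k r → 11 < n → r ≤ 6 → n ≡ 7 * k + r → SelfIdentifyingCode n (sidValue k r)
upper-bound n k r 11<n r≤6 n≡ with n ≟ 12
... | no  n≢12 = periodic-upper-bound n k r (≤∧≢⇒< 11<n (n≢12 ∘ sym)) r≤6 n≡
... | yes refl with 12≡7*k+r⇒k≡1×r≡5 k r r≤6 n≡
...   | refl , refl = code₁₂ , code₁₂-selfIdentifying , refl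

lower-bound : ∀ n k r → 11 < n → r ≤ 6 → n ≡ 7 * k + r →
              ∀ C → SelfIdentifying n C → sidValue k r ≤ ∣ C ∣
lower-bound n k r 11<n r≤6 refl C sid =
  sidValue-minimal k r ∣ C ∣ r≤6 (CodeCount.count-dichotomy n {{>-nonZero (<-trans z<s 11<n)}} C 11<n sid)

theorem8 : (n k r : ℕ) → 11 < n → r ≤ 6 → n ≡ 7 * k + r → γSID≡ n (sidValue k r)
theorem8 n k r 11<n r≤6 n≡ = upper-bound n k r 11<n r≤6 n≡ , lower-bound n k r 11<n r≤6 n≡
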